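{- Let $\tau$ be obtained from $\tau_0$ by adding pairs and let $\varphi_{0\tau}$ be a $\tau$-extension of $\varphi_0$. Let $m\ge1$ and let $\gamma$ be a first-order $\tau$-sentence such that $\varphi_{0\tau}\wedge\varphi_{1\tau}\wedge\gamma$ has no infinite model but has a finite model with at least $m$ elements. Let $\chi:=\varphi_{0\tau}\wedge(\varphi_{1\tau}\to\neg\gamma)$. Then: (a) the class $\mathrm{Mod}(\chi)$ is closed under $<$-substructures; (b) if a sentence $\forall x_1\ldots\forall x_k\,\mu_0$ with $\mu_0$ quantifier-free is finitely equivalent to $\chi$, then $k\ge m$.
   Context: $\tau_0=\{<,U_{\min},U_{\max},S\}$ with $<,S$ binary and $U_{\min},U_{\max}$ unary. $\varphi_0$ is the conjunction of: $\forall x\neg x<x$; $\forall x\forall y(x<y\vee x=y\vee y<x)$; $\forall x\forall y\forall z((x<y\wedge y<z)\to x<z)$; $\forall x\forall y(U_{\min}x\to(x=y\vee x<y))$; $\forall x\forall y(U_{\max}x\to(x=y\vee y<x))$; $\forall x\forall y(Sxy\to x<y)$; $\forall x\forall y\forall z((x<y\wedge y<z)\to\neg Sxz)$. $\varphi_1:=\exists x\,U_{\min}x\wedge\exists x\,U_{\max}x\wedge\forall x\forall y(x<y\to\exists z\,Sxz)$. $\tau$ is obtained from $\tau_0$ by adding pairs if $\tau=\tau_0\cup\{R,R^{c}\mid R\text{ standard}\}$ for finitely many new standard unary or binary symbols $R$, each with a complement symbol $R^c$ of the same arity. A relation symbol is negative in a formula if all its atomic occurrences lie in the scope of an odd number of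 negations (reading $\alpha\to\beta$ as $\neg\alpha\vee\beta$). A $\tau$-extension of $\varphi_0$ is a universal $\tau$-sentence $\varphi_{0\tau}$ having $\varphi_0$ and $\bigwedge_{R}\forall\bar x(\neg R\bar x\vee\neg R^c\bar x)$ as conjuncts, in which every relation symbol other than $<$ is negative. $\varphi_{1\tau}:=\varphi_1\wedge\bigwedge_{R}\forall\bar x(R\bar x\vee R^c\bar x)$. $\mathbf B$ is a $<$-substructure of $\mathbf A$ if $B\subseteq A$, $T^{\mathbf B}\subseteq T^{\mathbf A}$ for all $T\in\tau$ and $<^{\mathbf B}=<^{\mathbf A}\cap(B\times B)$. Structures have nonempty universes; $\mathrm{Mod}(\chi)$ is the class of all (finite and infinite) models; finitely equivalent means having the same finite models. -}

module Defs where

open import Level using (0ℓ)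
open import Data.Nat using (ℕ; zero; suc; _≤_)
open import Data.Fin using (Fin; #_)
open import Data.Vec using (Vec; []; _∷_; allFin)
import Data.Vec as V
open import Data.Bool using (Bool; true; false; not)
open import Data.Unit using (⊤)
open import Data.Empty using (⊥)
open import Data.Product using (Σ; _×_; ∃-syntax)
open import Data.Sum using (_⊎_)
open import Relation.Nullary using (¬_)
open import Relation.Binary.PropositionalEquality using (_≡_)
open import Function.Bundles using (_↔_)
open import Function.Definitions using (Injective)

data Arity : Set where
  one two : Arity

arityℕ : Arity → ℕ
arityℕ one = 1
arityℕ two = 2

-- A vocabulary τ obtained from τ₀ by adding pairs: n new standard symbols
-- R_i (i : Fin n) of arity ar i, each with a complement symbol R_i^c.
record PairSig : Set where
  field
    n  : ℕ
    ar : Fin n → Arity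

module Logic (σ : PairSig) where
  open PairSig σ

  data Sym : Set where
    lt umin umax succ : Sym
    new : Fin n → Sym
    cmp : Fin n → Sym

  arity : Sym → ℕ
  arity lt       = 2
  arity umin     = 1
  arity umax     = 1
  arity succ     = 2
  arity (new i)  = arityℕ (ar i)
  arity (cmp i)  = arityℕ (ar i)

  -- first-order τ-formulas (relational, with equality), de Bruijn variables:
  -- a formula with v free variables has variables Fin v; the quantifiers
  -- bind variable 0.
  data Formula : ℕ → Set where
    rel  : ∀ {v} (R : Sym) → Vec (Fin v) (arity R) → Formula v
    _≐_  : ∀ {v} → Fin v → Fin v → Formula v
    ⊤'   : ∀ {v} → Formula v
    ⊥'   : ∀ {v} → Formula v
    ¬'_  : ∀ {v} → Formula v → Formula v
    _∧'_ : ∀ {v} → Formula v → Formula v → Formula v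
    _∨'_ : ∀ {v} → Formula v → Formula v → Formula v
    _⇒'_ : ∀ {v} → Formula v → Formula v → Formula v
    ∀'_  : ∀ {v} → Formula (suc v) → Formula v
    ∃'_  : ∀ {v} → Formula (suc v) → Formula v

  infix  7 _≐_
  infix  6 ¬'_
  infixr 5 _∧'_
  infixr 4 _∨'_
  infixr 3 _⇒'_
  infix  2 ∀'_ ∃'_
  infix  8 _<'_

  Sentence : Set
  Sentence = Formula 0

  record Structure : Set₁ where
    field
      Carrier : Set
      point   : Carrier
      Rel     : (R : Sym) → Vec Carrier (arity R) → Set

  open Structure public

  ext : ∀ {v} {A : Set} → (Fin v → A) → A → Fin (suc v) → A
  ext ρ a Fin.zero    = a
  ext ρ a (Fin.suc i) = ρ i

  -- Tarskian satisfaction (classical once excluded middle is assumed)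
  Sat : ∀ {v} (M : Structure) → Formula v → (Fin v → Carrier M) → Set
  Sat M (rel R xs) ρ = Rel M R (V.map ρ xs)
  Sat M (x ≐ y)    ρ = ρ x ≡ ρ y
  Sat M ⊤'         ρ = ⊤
  Sat M ⊥'         ρ = ⊥
  Sat M (¬' φ)     ρ = ¬ Sat M φ ρ
  Sat M (φ ∧' ψ)   ρ = Sat M φ ρ × Sat M ψ ρ
  Sat M (φ ∨' ψ)   ρ = Sat M φ ρ ⊎ Sat M ψ ρ
  Sat M (φ ⇒' ψ)   ρ = Sat M φ ρ → Sat M ψ ρ
  Sat M (∀' φ)     ρ = (a : Carrier M) → Sat M φ (ext ρ a)
  Sat M (∃' φ)     ρ = Σ (Carrier M) (λ a → Sat M φ (ext ρ a))

  _⊨_ : Structure → Sentence → Set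
  M ⊨ φ = Sat M φ (λ ())

  Finite : Structure → Set
  Finite M = Σ ℕ (λ k → Fin k ↔ Carrier M)

  Infinite : Structure → Set
  Infinite M = ¬ Finite M

  FiniteAtLeast : ℕ → Structure → Set
  FiniteAtLeast m M = Σ ℕ (λ k → (m ≤ k) × (Fin k ↔ Carrier M))

  QF : ∀ {v} → Formula v → Set
  QF (rel R xs) = ⊤
  QF (x ≐ y)    = ⊤
  QF ⊤'         = ⊤
  QF ⊥'         = ⊤
  QF (¬' φ)     = QF φ
  QF (φ ∧' ψ)   = QF φ × QF ψ
  QF (φ ∨' ψ)   = QF φ × QF ψ
  QF (φ ⇒' ψ)   = QF φ × QF ψ
  QF (∀' φ)     = ⊥
  QF (∃' φ)     = ⊥

  data Universal : ∀ {v} → Formula v → Set where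
    qf   : ∀ {v} {φ : Formula v} → QF φ → Universal φ
    conj : ∀ {v} {φ ψ : Formula v} → Universal φ → Universal ψ → Universal (φ ∧' ψ)
    disj : ∀ {v} {φ ψ : Formula v} → Universal φ → Universal ψ → Universal (φ ∨' ψ)
    univ : ∀ {v} {φ : Formula (suc v)} → Universal φ → Universal (∀' φ)

  -- NegAt R p φ : every atomic occurrence of R in φ is under an odd number
  -- of negations, where p = true means "currently under an even number";
  -- α ⇒ β is read as ¬α ∨ β.
  NegAt : ∀ {v} → Sym → Bool → Formula v → Set
  NegAt R true  (rel R' xs) = ¬ (R' ≡ R)
  NegAt R false (rel R' xs) = ⊤
  NegAt R p (x ≐ y)    = ⊤
  NegAt R p ⊤'         = ⊤
  NegAt R p ⊥'         = ⊤
  NegAt R p (¬' φ)     = NegAt R (not p) φ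
  NegAt R p (φ ∧' ψ)   = NegAt R p φ × NegAt R p ψ
  NegAt R p (φ ∨' ψ)   = NegAt R p φ × NegAt R p ψ
  NegAt R p (φ ⇒' ψ)   = NegAt R (not p) φ × NegAt R p ψ
  NegAt R p (∀' φ)     = NegAt R p φ
  NegAt R p (∃' φ)     = NegAt R p φ

  Negative : ∀ {v} → Sym → Formula v → Set
  Negative R φ = NegAt R true φ

  data Conjunct {v} (α : Formula v) : Formula v → Set where
    here  : Conjunct α α
    left  : ∀ {φ ψ} → Conjunct α φ → Conjunct α (φ ∧' ψ)
    right : ∀ {φ ψ} → Conjunct α ψ → Conjunct α (φ ∧' ψ)

  ∀ⁿ : (k : ℕ) → Formula k → Sentence
  ∀ⁿ zero    φ = φ
  ∀ⁿ (suc k) φ = ∀ⁿ k (∀' φ)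

  ⋀ : ∀ {v} (k : ℕ) → (Fin k → Formula v) → Formula v
  ⋀ zero    f = ⊤'
  ⋀ (suc k) f = f Fin.zero ∧' ⋀ k (λ i → f (Fin.suc i))

  _<'_ : ∀ {v} → Fin v → Fin v → Formula v
  x <' y = rel lt (x ∷ y ∷ [])

  S' : ∀ {v} → Fin v → Fin v → Formula v
  S' x y = rel succ (x ∷ y ∷ [])

  Umin' Umax' : ∀ {v} → Fin v → Formula v
  Umin' x = rel umin (x ∷ [])
  Umax' x = rel umax (x ∷ [])

  -- φ₀ (variables: in ∀x∀y, x = #1, y = #0; in ∀x∀y∀z, x = #2, y = #1, z = #0)
  φ₀ : Sentence
  φ₀ = (∀' ¬' (# 0 <' # 0))
    ∧' (∀' ∀' ((# 1 <' # 0) ∨' (# 1 ≐ # 0) ∨' (# 0 <' # 1)))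
    ∧' (∀' ∀' ∀' (((# 2 <' # 1) ∧' (# 1 <' # 0)) ⇒' (# 2 <' # 0)))
    ∧' (∀' ∀' (Umin' (# 1) ⇒' ((# 1 ≐ # 0) ∨' (# 1 <' # 0))))
    ∧' (∀' ∀' (Umax' (# 1) ⇒' ((# 1 ≐ # 0) ∨' (# 0 <' # 1))))
    ∧' (∀' ∀' (S' (# 1) (# 0) ⇒' (# 1 <' # 0)))
    ∧' (∀' ∀' ∀' (((# 2 <' # 1) ∧' (# 1 <' # 0)) ⇒' ¬' S' (# 2) (# 0)))

  φ₁ : Sentence
  φ₁ = (∃' Umin' (# 0))
    ∧' (∃' Umax' (# 0))
    ∧' (∀' ∀' ((# 1 <' # 0) ⇒' (∃' S' (# 2) (# 0))))

  disjointPair : Fin n → Sentence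
  disjointPair i = ∀ⁿ (arityℕ (ar i))
    ((¬' rel (new i) (allFin _)) ∨' (¬' rel (cmp i) (allFin _)))

  coverPair : Fin n → Sentence
  coverPair i = ∀ⁿ (arityℕ (ar i))
    (rel (new i) (allFin _) ∨' rel (cmp i) (allFin _))

  IsExtension : Sentence → Set
  IsExtension φ = Universal φ
                × Conjunct φ₀ φ
                × ((i : Fin n) → Conjunct (disjointPair i) φ)
                × ((R : Sym) → ¬ (R ≡ lt) → Negative R φ)

  φ₁τ : Sentence
  φ₁τ = φ₁ ∧' ⋀ n coverPair

  χ : Sentence → Sentence → Sentence
  χ φ₀τ γ = φ₀τ ∧' (φ₁τ ⇒' ¬' γ)

  -- B is (isomorphic to) a <-substructure of A, via an injection ι
  LtSubstructure : Structure → Structure → Set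
  LtSubstructure B A =
    Σ (Carrier B → Carrier A) λ ι →
        Injective _≡_ _≡_ ι
      × ((R : Sym) (xs : Vec (Carrier B) (arity R)) → Rel B R xs → Rel A R (V.map ι xs))
      × ((xs : Vec (Carrier B) 2) → Rel A lt (V.map ι xs) → Rel B lt xs)

  ClosedUnderLtSubstructures : Sentence → Set₁
  ClosedUnderLtSubstructures φ =
    (A B : Structure) → LtSubstructure B A → A ⊨ φ → B ⊨ φ

  FinitelyEquivalent : Sentence → Sentence → Set₁
  FinitelyEquivalent φ ψ =
    (M : Structure) → Finite M → (M ⊨ φ → M ⊨ ψ) × (M ⊨ ψ → M ⊨ φ)

-- (a) φ₀τ is universal and every symbol other than < occurs in it only negatively, so it
-- passes to <-substructures. Suppose a <-substructure B of a model A of χ satisfies φ₁τ ∧ γ.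
-- Then B is finite, and the embedding is onto: if b is the greatest element of B lying below
-- a given a ∈ A, and b < a, then the S-successor of b in B is an S-successor in A, so it is a.
-- It also reflects every relation, since U_min, U_max and S-successors are unique in A and
-- R, R^c cover B but are disjoint in A. Hence A ≅ B satisfies φ₁τ ∧ γ, a contradiction.
-- (b) Let M be a finite model of φ₀τ ∧ φ₁τ ∧ γ with more than k elements, and suppose the
-- universal closure of μ₀ is finitely equivalent to χ. The substructure induced on the values
-- of any k-tuple of M satisfies φ₀τ, and cannot satisfy φ₁τ since it would then be all of M;
-- so it is a finite model of χ, and the tuple satisfies μ₀ there, hence in M. Thus M ⊨ χ,
-- which contradicts M ⊨ φ₁τ ∧ γ.
module Submission where

open import Defs
open import Level using (0ℓ)
open import Axiom.ExcludedMiddle using (ExcludedMiddle)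
open import Data.Nat using (ℕ; _≤_)
open import Data.Product using (Σ; _×_)
open import Relation.Nullary using (¬_)

open import Axiom.DoubleNegationElimination using (em⇒dne)
open import Data.Nat using (zero; suc; _<_)
open import Data.Nat.Properties using (≮⇒≥; <-≤-trans; <⇒≱)
open import Data.Fin using (Fin; zero; suc)
open import Data.Fin.Properties using (¬Fin0; any?; injective⇒≤; 1↔⊤)
open import Data.Vec using (Vec; []; _∷_; lookup)
import Data.Vec as V
open import Data.Vec.Properties using (map-cong; map-∘; map-id; map-lookup-allFin)
open import Data.Bool using (Bool; true; false)
open import Data.Unit using (⊤; tt)
open import Data.Empty using (⊥; ⊥-elim)
open import Data.Product using (_,_; proj₁; proj₂; ∃-syntax)
open import Data.Sum using (_⊎_; inj₁; inj₂; map₁)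
open import Function.Base using (_∘_)
open import Function.Bundles using (Inverse; Injection; _↔_)
open import Function.Definitions using (Injective)
open import Function.Properties.Inverse using (↔⇒↣)
open import Function.Construct.Identity using (↔-id)
open import Relation.Binary.Definitions using (DecidableEquality)
open import Relation.Binary.PropositionalEquality
  using (_≡_; refl; sym; trans; cong; subst)
open import Relation.Nullary using (yes; no)

onto⇒≤ : ∀ {C : Set} {n k} → Fin n ↔ C → (ρ : Fin k → C) →
                 (∀ c → ∃[ i ] ρ i ≡ c) → n ≤ k
onto⇒≤ {n = n} {k} enum ρ covers = injective⇒≤ index-injective
  where
  open Inverse enum using (to)
  index : Fin n → Fin k
  index x = proj₁ (covers (to x))
  index-injective : Injective _≡_ _≡_ index
  index-injective {x} {y} same =
    Injection.injective (↔⇒↣ enum)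
      (trans (sym (proj₂ (covers (to x)))) (trans (cong ρ same) (proj₂ (covers (to y)))))

record Image {C : Set} {k : ℕ} (ρ : Fin k → C) : Set where
  field
    size           : ℕ
    enum           : Fin size → C
    enum-injective : Injective _≡_ _≡_ enum
    index          : ∀ i → ∃[ j ] enum j ≡ ρ i
    preimage       : ∀ j → ∃[ i ] ρ i ≡ enum j

image : ∀ {C : Set} → DecidableEquality C → ∀ {k} (ρ : Fin k → C) → Image ρ
image _≟_ {zero} ρ = record
  { size = 0 ; enum = λ () ; enum-injective = λ {x} → ⊥-elim (¬Fin0 x)
  ; index = λ () ; preimage = λ () }
image {C} _≟_ {suc k} ρ = extend (image _≟_ (ρ ∘ suc))
  where
  extend : Image (ρ ∘ suc) → Image ρ
  extend im with any? (λ j → Image.enum im j ≟ ρ zero)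
  ... | yes (j , hit) = record
    { size = size ; enum = enum ; enum-injective = enum-injective
    ; index = λ { zero → j , hit ; (suc i) → index i }
    ; preimage = λ j′ → suc (proj₁ (preimage j′)) , proj₂ (preimage j′) }
    where open Image im
  ... | no miss = record
    { size = suc size ; enum = enum′ ; enum-injective = enum′-injective
    ; index = λ { zero → zero , refl ; (suc i) → suc (proj₁ (index i)) , proj₂ (index i) }
    ; preimage = λ { zero → zero , refl
                   ; (suc j) → suc (proj₁ (preimage j)) , proj₂ (preimage j) } }
    where
    open Image im
    enum′ : Fin (suc size) → C
    enum′ zero    = ρ zero
    enum′ (suc j) = enum j
    enum′-injective : Injective _≡_ _≡_ enum′
    enum′-injective {zero}  {zero}  _    = refl
    enum′-injective {zero}  {suc j} same = ⊥-elim (miss (j , sym same))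
    enum′-injective {suc i} {zero}  same = ⊥-elim (miss (i , same))
    enum′-injective {suc i} {suc j} same = cong suc (enum-injective same)

module _ (σ : PairSig) where
  open PairSig σ
  open Logic σ

  record Embedding (B A : Structure) : Set where
    field
      ι           : Carrier B → Carrier A
      ι-injective : Injective _≡_ _≡_ ι
      ι-preserves : ∀ R xs → Rel B R xs → Rel A R (V.map ι xs)

    Reflects : Sym → Set
    Reflects R = ∀ xs → Rel A R (V.map ι xs) → Rel B R xs

  module _ {A B : Structure} (e : Embedding B A) where
    open Embedding e

    Tracks : ∀ {v} → (Fin v → Carrier A) → (Fin v → Carrier B) → Set
    Tracks ρ ρ′ = ∀ i → ρ i ≡ ι (ρ′ i)

    map-tracks : ∀ {v l} {ρ ρ′} → Tracks {v} ρ ρ′ →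
                 (xs : Vec (Fin v) l) → V.map ρ xs ≡ V.map ι (V.map ρ′ xs)
    map-tracks {ρ′ = ρ′} t xs = trans (map-cong t xs) (map-∘ ι ρ′ xs)

    ext-tracks : ∀ {v} {ρ ρ′ a b} → Tracks {v} ρ ρ′ → a ≡ ι b → Tracks (ext ρ a) (ext ρ′ b)
    ext-tracks t a≡ιb zero    = a≡ιb
    ext-tracks t a≡ιb (suc i) = t i

    Transfer : ∀ {v} → Bool → Formula v → (Fin v → Carrier A) → (Fin v → Carrier B) → Set
    Transfer true  φ ρ ρ′ = Sat A φ ρ → Sat B φ ρ′
    Transfer false φ ρ ρ′ = Sat B φ ρ′ → Sat A φ ρ

    Admissible : ∀ {v} → Bool → Formula v → Set
    Admissible p φ = ∀ R → NegAt R p φ ⊎ Reflects R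

    on-left : ∀ {P Q : Sym → Set} → (∀ R → P R × Q R ⊎ Reflects R) → ∀ R → P R ⊎ Reflects R
    on-left h R = map₁ proj₁ (h R)

    on-right : ∀ {P Q : Sym → Set} → (∀ R → P R × Q R ⊎ Reflects R) → ∀ R → Q R ⊎ Reflects R
    on-right h R = map₁ proj₂ (h R)

    qf-transfer : ∀ {v} p (φ : Formula v) → QF φ → Admissible p φ →
                  ∀ {ρ ρ′} → Tracks ρ ρ′ → Transfer p φ ρ ρ′
    qf-transfer true (rel R xs) _ h t s with h R
    ... | inj₁ R≢R     = ⊥-elim (R≢R refl)
    ... | inj₂ reflect = reflect _ (subst (Rel A R) (map-tracks t xs) s)
    qf-transfer false (rel R xs) _ _ t s =
      subst (Rel A R) (sym (map-tracks t xs)) (ι-preserves R _ s)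
    qf-transfer true  (x ≐ y) _ _ t s = ι-injective (trans (sym (t x)) (trans s (t y)))
    qf-transfer false (x ≐ y) _ _ t s = trans (t x) (trans (cong ι s) (sym (t y)))
    qf-transfer true  ⊤' _ _ _ _ = tt
    qf-transfer false ⊤' _ _ _ _ = tt
    qf-transfer true  ⊥' _ _ _ ()
    qf-transfer false ⊥' _ _ _ ()
    qf-transfer true  (¬' φ) q h t s s′ = s (qf-transfer false φ q h t s′)
    qf-transfer false (¬' φ) q h t s s′ = s (qf-transfer true φ q h t s′)
    qf-transfer true (φ ∧' ψ) (q , q′) h t (s , s′) =
      qf-transfer true φ q (on-left h) t s , qf-transfer true ψ q′ (on-right h) t s′
    qf-transfer false (φ ∧' ψ) (q , q′) h t (s , s′) =
      qf-transfer false φ q (on-left h) t s , qf-transfer false ψ q′ (on-right h) t s′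
    qf-transfer true (φ ∨' ψ) (q , _) h t (inj₁ s) = inj₁ (qf-transfer true φ q (on-left h) t s)
    qf-transfer true (φ ∨' ψ) (_ , q) h t (inj₂ s) = inj₂ (qf-transfer true ψ q (on-right h) t s)
    qf-transfer false (φ ∨' ψ) (q , _) h t (inj₁ s) = inj₁ (qf-transfer false φ q (on-left h) t s)
    qf-transfer false (φ ∨' ψ) (_ , q) h t (inj₂ s) = inj₂ (qf-transfer false ψ q (on-right h) t s)
    qf-transfer true (φ ⇒' ψ) (q , q′) h t s s′ =
      qf-transfer true ψ q′ (on-right h) t (s (qf-transfer false φ q (on-left h) t s′))
    qf-transfer false (φ ⇒' ψ) (q , q′) h t s s′ =
      qf-transfer false ψ q′ (on-right h) t (s (qf-transfer true φ q (on-left h) t s′))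

    universal-down : ∀ {v} {φ : Formula v} → Universal φ → Admissible true φ →
                     ∀ {ρ ρ′} → Tracks ρ ρ′ → Sat A φ ρ → Sat B φ ρ′
    universal-down (qf {φ = φ} q) h t = qf-transfer true φ q h t
    universal-down (conj u u′) h t (s , s′) =
      universal-down u (on-left h) t s , universal-down u′ (on-right h) t s′
    universal-down (disj u _) h t (inj₁ s) = inj₁ (universal-down u (on-left h) t s)
    universal-down (disj _ u) h t (inj₂ s) = inj₂ (universal-down u (on-right h) t s)
    universal-down (univ u) h t s b = universal-down u h (ext-tracks t refl) (s (ι b))

    module _ (reflects : ∀ R → Reflects R) (onto : ∀ a → ∃[ b ] ι b ≡ a) where
      mutual
        sat-down : ∀ {v} (φ : Formula v) {ρ ρ′} → Tracks ρ ρ′ → Sat A φ ρ → Sat B φ ρ′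
        sat-down (rel R xs) t s = reflects R _ (subst (Rel A R) (map-tracks t xs) s)
        sat-down (x ≐ y) t s = ι-injective (trans (sym (t x)) (trans s (t y)))
        sat-down ⊤' t s = s
        sat-down ⊥' t s = s
        sat-down (¬' φ) t s s′ = s (sat-up φ t s′)
        sat-down (φ ∧' ψ) t (s , s′) = sat-down φ t s , sat-down ψ t s′
        sat-down (φ ∨' ψ) t (inj₁ s) = inj₁ (sat-down φ t s)
        sat-down (φ ∨' ψ) t (inj₂ s) = inj₂ (sat-down ψ t s)
        sat-down (φ ⇒' ψ) t s s′ = sat-down ψ t (s (sat-up φ t s′))
        sat-down (∀' φ) t s b = sat-down φ (ext-tracks t refl) (s (ι b))
        sat-down (∃' φ) t (a , s) with onto a
        ... | b , ιb≡a = b , sat-down φ (ext-tracks t (sym ιb≡a)) s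

        sat-up : ∀ {v} (φ : Formula v) {ρ ρ′} → Tracks ρ ρ′ → Sat B φ ρ′ → Sat A φ ρ
        sat-up (rel R xs) t s = subst (Rel A R) (sym (map-tracks t xs)) (ι-preserves R _ s)
        sat-up (x ≐ y) t s = trans (t x) (trans (cong ι s) (sym (t y)))
        sat-up ⊤' t s = s
        sat-up ⊥' t s = s
        sat-up (¬' φ) t s s′ = s (sat-down φ t s′)
        sat-up (φ ∧' ψ) t (s , s′) = sat-up φ t s , sat-up ψ t s′
        sat-up (φ ∨' ψ) t (inj₁ s) = inj₁ (sat-up φ t s)
        sat-up (φ ∨' ψ) t (inj₂ s) = inj₂ (sat-up ψ t s)
        sat-up (φ ⇒' ψ) t s s′ = sat-up ψ t (s (sat-down φ t s′))
        sat-up (∀' φ) t s a with onto a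
        ... | b , ιb≡a = sat-up φ (ext-tracks t (sym ιb≡a)) (s b)
        sat-up (∃' φ) t (b , s) = ι b , sat-up φ (ext-tracks t refl) s

  identity : (M : Structure) → Embedding M M
  identity M = record
    { ι = λ x → x ; ι-injective = λ same → same
    ; ι-preserves = λ R xs → subst (Rel M R) (sym (map-id xs)) }

  sat-cong : ∀ {v} (M : Structure) (φ : Formula v) {ρ ρ′} →
             (∀ i → ρ i ≡ ρ′ i) → Sat M φ ρ → Sat M φ ρ′
  sat-cong M = sat-down (identity M) (λ R xs → subst (Rel M R) (map-id xs)) (λ a → a , refl)

  ∀ⁿ-intro : (M : Structure) (k : ℕ) (φ : Formula k) {ρ₀ : Fin 0 → Carrier M} →
             (∀ ρ → Sat M φ ρ) → Sat M (∀ⁿ k φ) ρ₀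
  ∀ⁿ-intro M zero    φ holds = holds _
  ∀ⁿ-intro M (suc k) φ holds = ∀ⁿ-intro M k (∀' φ) (λ ρ a → holds (ext ρ a))

  ∀ⁿ-elim : (M : Structure) (k : ℕ) (φ : Formula k) {ρ₀ : Fin 0 → Carrier M} →
            Sat M (∀ⁿ k φ) ρ₀ → ∀ ρ → Sat M φ ρ
  ∀ⁿ-elim M zero φ s ρ = sat-cong M φ (λ ()) s
  ∀ⁿ-elim M (suc k) φ s ρ =
    sat-cong M φ (λ { zero → refl ; (suc i) → refl }) (∀ⁿ-elim M k (∀' φ) s (ρ ∘ suc) (ρ zero))

  conjunct-sat : ∀ {v} (M : Structure) {α φ : Formula v} {ρ} → Conjunct α φ → Sat M φ ρ → Sat M α ρ
  conjunct-sat M here      s       = s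
  conjunct-sat M (left c)  (s , _) = conjunct-sat M c s
  conjunct-sat M (right c) (_ , s) = conjunct-sat M c s

  ⋀-elim : ∀ {v} (M : Structure) {k} {f : Fin k → Formula v} {ρ} → Sat M (⋀ k f) ρ → ∀ i → Sat M (f i) ρ
  ⋀-elim M (s , _) zero    = s
  ⋀-elim M (_ , s) (suc i) = ⋀-elim M s i

  covered : (M : Structure) (i : Fin n) → M ⊨ coverPair i →
            ∀ xs → Rel M (new i) xs ⊎ Rel M (cmp i) xs
  covered M i s xs with ∀ⁿ-elim M (arityℕ (ar i)) _ s (lookup xs)
  ... | inj₁ r = inj₁ (subst (Rel M (new i)) (map-lookup-allFin xs) r)
  ... | inj₂ r = inj₂ (subst (Rel M (cmp i)) (map-lookup-allFin xs) r)

  disjoint : (M : Structure) (i : Fin n) → M ⊨ disjointPair i →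
             ∀ xs → Rel M (new i) xs → ¬ Rel M (cmp i) xs
  disjoint M i s xs r c with ∀ⁿ-elim M (arityℕ (ar i)) _ s (lookup xs)
  ... | inj₁ ¬r = ¬r (subst (Rel M (new i)) (sym (map-lookup-allFin xs)) r)
  ... | inj₂ ¬c = ¬c (subst (Rel M (cmp i)) (sym (map-lookup-allFin xs)) c)

  first-argument : ∀ R → Fin (arity R)
  first-argument lt      = zero
  first-argument umin    = zero
  first-argument umax    = zero
  first-argument succ    = zero
  first-argument (new i) with ar i
  ... | one = zero
  ... | two = zero
  first-argument (cmp i) with ar i
  ... | one = zero
  ... | two = zero

  closed-qf-absolute : ∀ {M N} (μ : Formula 0) → QF μ → ∀ {ρ ρ′} → Sat M μ ρ → Sat N μ ρ′
  closed-qf-absolute (rel R xs) _ _ = ⊥-elim (¬Fin0 (lookup xs (first-argument R)))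
  closed-qf-absolute (() ≐ _)
  closed-qf-absolute ⊤' _ _ = tt
  closed-qf-absolute ⊥' _ ()
  closed-qf-absolute (¬' μ) q s t = s (closed-qf-absolute μ q t)
  closed-qf-absolute (μ ∧' ν) (q , q′) (s , t) = closed-qf-absolute μ q s , closed-qf-absolute ν q′ t
  closed-qf-absolute (μ ∨' ν) (q , _) (inj₁ s) = inj₁ (closed-qf-absolute μ q s)
  closed-qf-absolute (μ ∨' ν) (_ , q) (inj₂ s) = inj₂ (closed-qf-absolute ν q s)
  closed-qf-absolute (μ ⇒' ν) (q , q′) s t = closed-qf-absolute ν q′ (s (closed-qf-absolute μ q t))

  Lt Succ : (M : Structure) → Carrier M → Carrier M → Set
  Lt   M x y = Rel M lt (x ∷ y ∷ [])
  Succ M x y = Rel M succ (x ∷ y ∷ [])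

  Min Max : (M : Structure) → Carrier M → Set
  Min M x = Rel M umin (x ∷ [])
  Max M x = Rel M umax (x ∷ [])

  record OrderAxioms (M : Structure) : Set where
    field
      <-irrefl      : ∀ x → ¬ Lt M x x
      <-trichotomy  : ∀ x y → Lt M x y ⊎ x ≡ y ⊎ Lt M y x
      <-trans       : ∀ x y z → Lt M x y × Lt M y z → Lt M x z
      min-least     : ∀ x y → Min M x → x ≡ y ⊎ Lt M x y
      max-greatest  : ∀ x y → Max M x → x ≡ y ⊎ Lt M y x
      succ⇒<        : ∀ x y → Succ M x y → Lt M x y
      succ-no-between : ∀ x y z → Lt M x y × Lt M y z → ¬ Succ M x z

    _≼_ : Carrier M → Carrier M → Set
    x ≼ y = x ≡ y ⊎ Lt M x y

    ≼⇒≯ : ∀ {x y} → x ≼ y → ¬ Lt M y x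
    ≼⇒≯ {x}     (inj₁ refl) y<x = <-irrefl x y<x
    ≼⇒≯ {x} {y} (inj₂ x<y)  y<x = <-irrefl x (<-trans x y x (x<y , y<x))

    ≼-<-trans : ∀ {x y z} → x ≼ y → Lt M y z → Lt M x z
    ≼-<-trans             (inj₁ refl) y<z = y<z
    ≼-<-trans {x} {y} {z} (inj₂ x<y)  y<z = <-trans x y z (x<y , y<z)

    <-≼-trans : ∀ {x y z} → Lt M x y → y ≼ z → Lt M x z
    <-≼-trans             x<y (inj₁ refl) = x<y
    <-≼-trans {x} {y} {z} x<y (inj₂ y<z)  = <-trans x y z (x<y , y<z)

    ≼⊎> : ∀ x y → x ≼ y ⊎ Lt M y x
    ≼⊎> x y with <-trichotomy x y
    ... | inj₁ x<y        = inj₁ (inj₂ x<y)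
    ... | inj₂ (inj₁ x≡y) = inj₁ (inj₁ x≡y)
    ... | inj₂ (inj₂ y<x) = inj₂ y<x

    ≼-max : ∀ {x y} → Max M y → x ≼ y
    ≼-max {x} {y} max with max-greatest y x max
    ... | inj₁ y≡x = inj₁ (sym y≡x)
    ... | inj₂ x<y = inj₂ x<y

    min-unique : ∀ {x y} → Min M x → Min M y → x ≡ y
    min-unique {x} {y} min-x min-y with min-least x y min-x
    ... | inj₁ x≡y = x≡y
    ... | inj₂ x<y = ⊥-elim (≼⇒≯ (min-least y x min-y) x<y)

    max-unique : ∀ {x y} → Max M x → Max M y → x ≡ y
    max-unique max-x max-y with ≼-max max-y
    ... | inj₁ x≡y = x≡y
    ... | inj₂ x<y = ⊥-elim (≼⇒≯ (≼-max max-x) x<y)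

    succ-least : ∀ {x y z} → Succ M x z → Lt M x y → z ≼ y
    succ-least {x} {y} {z} x↝z x<y with ≼⊎> z y
    ... | inj₁ z≼y = z≼y
    ... | inj₂ y<z = ⊥-elim (succ-no-between x y z (x<y , y<z) x↝z)

    succ-unique : ∀ {x y z} → Succ M x y → Succ M x z → y ≡ z
    succ-unique {x} {y} {z} x↝y x↝z with succ-least x↝y (succ⇒< x z x↝z)
    ... | inj₁ y≡z = y≡z
    ... | inj₂ y<z = ⊥-elim (succ-no-between x y z (succ⇒< x y x↝y , y<z) x↝z)

    greatest-below : {Y : Set} (f : Y → Carrier M) (k : ℕ) (g : Fin k → Y) (a : Carrier M) (y₀ : Y) →
                     f y₀ ≼ a → Σ Y λ y → f y ≼ a × (∀ i → f (g i) ≼ a → f (g i) ≼ f y)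
    greatest-below f zero g a y₀ y₀≼a = y₀ , y₀≼a , λ ()
    greatest-below f (suc k) g a y₀ y₀≼a
      with greatest-below f k (g ∘ suc) a y₀ y₀≼a | ≼⊎> (f (g zero)) a
    ... | y , y≼a , above | inj₂ a<g₀ =
      y , y≼a , λ { zero g₀≼a → ⊥-elim (≼⇒≯ g₀≼a a<g₀) ; (suc i) → above i }
    ... | y , y≼a , above | inj₁ g₀≼a with ≼⊎> (f (g zero)) (f y)
    ...   | inj₁ g₀≼y = y , y≼a , λ { zero _ → g₀≼y ; (suc i) → above i }
    ...   | inj₂ y<g₀ =
      g zero , g₀≼a , λ { zero _ → inj₁ refl ; (suc i) gᵢ≼a → inj₂ (≼-<-trans (above i gᵢ≼a) y<g₀) }

  φ₀-order-axioms : ∀ {M} → M ⊨ φ₀ → OrderAxioms M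
  φ₀-order-axioms (irrefl , trichotomy , trans′ , min , max , succ<  , no-between) = record
    { <-irrefl = irrefl ; <-trichotomy = trichotomy ; <-trans = trans′
    ; min-least = min ; max-greatest = max ; succ⇒< = succ< ; succ-no-between = no-between }

  module _ {A B : Structure} (e : Embedding B A) (order : OrderAxioms A)
           (reflects-< : Embedding.Reflects e lt) where
    open Embedding e
    open OrderAxioms order

    φ₁τ⇒reflects : (∀ i → A ⊨ disjointPair i) → B ⊨ φ₁τ → ∀ R → Reflects R
    φ₁τ⇒reflects disjoint-A (((bmin , min) , (bmax , max) , succ-exists) , cover) = reflects
      where
      reflects : ∀ R → Reflects R
      reflects lt = reflects-<
      reflects umin (x ∷ []) min-x =
        subst (Min B) (ι-injective (min-unique (ι-preserves umin _ min) min-x)) min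
      reflects umax (x ∷ []) max-x =
        subst (Max B) (ι-injective (max-unique (ι-preserves umax _ max) max-x)) max
      reflects succ (x ∷ y ∷ []) x↝y with succ-exists x y (reflects-< _ (succ⇒< _ _ x↝y))
      ... | z , x↝z = subst (Succ B x) (ι-injective (succ-unique (ι-preserves succ _ x↝z) x↝y)) x↝z
      reflects (new i) xs r with covered B i (⋀-elim B cover i) xs
      ... | inj₁ r′ = r′
      ... | inj₂ c  = ⊥-elim (disjoint A i (disjoint-A i) _ r (ι-preserves (cmp i) xs c))
      reflects (cmp i) xs c with covered B i (⋀-elim B cover i) xs
      ... | inj₁ r  = ⊥-elim (disjoint A i (disjoint-A i) _ (ι-preserves (new i) xs r) c)
      ... | inj₂ c′ = c′

    φ₁⇒onto : B ⊨ φ₁ → Finite B → ∀ a → ∃[ b ] ι b ≡ a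
    φ₁⇒onto ((bmin , min) , (bmax , max) , succ-exists) (k , enumeration) a
      with greatest-below ι k (Inverse.to enumeration) a bmin (min-least _ a (ι-preserves umin _ min))
    ... | b , inj₁ ιb≡a , _     = b , ιb≡a
    ... | b , inj₂ ιb<a , below = successor-hits
      where
      open Inverse enumeration using (to; from; strictlyInverseˡ)
      greatest : ∀ y → ι y ≼ a → ι y ≼ ι b
      greatest y y≼a = subst (λ w → ι w ≼ ι b) (strictlyInverseˡ y)
                         (below (from y) (subst (λ w → ι w ≼ a) (sym (strictlyInverseˡ y)) y≼a))
      successor-hits : ∃[ z ] ι z ≡ a
      successor-hits with succ-exists b bmax (reflects-< _ (<-≼-trans ιb<a (≼-max (ι-preserves umax _ max))))
      ... | z , b↝z with succ-least (ι-preserves succ _ b↝z) ιb<a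
      ...   | inj₁ ιz≡a = z , ιz≡a
      ...   | inj₂ ιz<a = ⊥-elim (≼⇒≯ (greatest z (inj₂ ιz<a)) (succ⇒< _ _ (ι-preserves succ _ b↝z)))

  induced : (M : Structure) {C : Set} → (C → Carrier M) → C → Structure
  induced M {C} f c = record { Carrier = C ; point = c ; Rel = λ R xs → Rel M R (V.map f xs) }

  induced-embedding : (M : Structure) {C : Set} (f : C → Carrier M) (c : C) →
                      Injective _≡_ _≡_ f → Embedding (induced M f c) M
  induced-embedding M f c f-injective =
    record { ι = f ; ι-injective = f-injective ; ι-preserves = λ R xs r → r }

  point-structure : Structure
  point-structure = record { Carrier = ⊤ ; point = tt ; Rel = λ _ _ → ⊥ }

  module _ {φ₀τ : Sentence} (extension : IsExtension φ₀τ) where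
    private
      universal : Universal φ₀τ
      universal = proj₁ extension
      has-φ₀ : Conjunct φ₀ φ₀τ
      has-φ₀ = proj₁ (proj₂ extension)
      has-disjoint : ∀ i → Conjunct (disjointPair i) φ₀τ
      has-disjoint = proj₁ (proj₂ (proj₂ extension))
      negative : ∀ R → ¬ R ≡ lt → Negative R φ₀τ
      negative = proj₂ (proj₂ (proj₂ extension))

    extension-order : ∀ {M} → M ⊨ φ₀τ → OrderAxioms M
    extension-order {M} s = φ₀-order-axioms (conjunct-sat M has-φ₀ s)

    extension-disjoint : ∀ {M} → M ⊨ φ₀τ → ∀ i → M ⊨ disjointPair i
    extension-disjoint {M} s i = conjunct-sat M (has-disjoint i) s

    extension-down : ∀ {A B} (e : Embedding B A) → Embedding.Reflects e lt → A ⊨ φ₀τ → B ⊨ φ₀τ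
    extension-down e reflects-< = universal-down e universal admissible (λ ())
      where
      admissible : Admissible e true φ₀τ
      admissible lt      = inj₂ reflects-<
      admissible umin    = inj₁ (negative umin λ ())
      admissible umax    = inj₁ (negative umax λ ())
      admissible succ    = inj₁ (negative succ λ ())
      admissible (new i) = inj₁ (negative (new i) λ ())
      admissible (cmp i) = inj₁ (negative (cmp i) λ ())

    point-model : ∀ {M γ} → M ⊨ φ₀τ → point-structure ⊨ χ φ₀τ γ
    point-model {M} M⊨φ₀τ = extension-down e reflects-< M⊨φ₀τ , λ { (((_ , ()) , _) , _) _ }
      where
      e : Embedding point-structure M
      e = record { ι = λ _ → point M ; ι-injective = λ _ → refl ; ι-preserves = λ _ _ () }
      reflects-< : Embedding.Reflects e lt
      reflects-< (_ ∷ _ ∷ []) = OrderAxioms.<-irrefl (extension-order M⊨φ₀τ) (point M)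

    module _ (γ : Sentence) where

      χ-closed : ExcludedMiddle 0ℓ →
                 ¬ (Σ Structure λ M → Infinite M × (M ⊨ (φ₀τ ∧' φ₁τ ∧' γ))) →
                 ClosedUnderLtSubstructures (χ φ₀τ γ)
      χ-closed lem no-infinite A B (ι , ι-injective , ι-preserves , reflects-<) (A⊨φ₀τ , A⊭φ₁τ∧γ) =
        B⊨φ₀τ , B⊭φ₁τ∧γ
        where
        e : Embedding B A
        e = record { ι = ι ; ι-injective = ι-injective ; ι-preserves = ι-preserves }
        B⊨φ₀τ : B ⊨ φ₀τ
        B⊨φ₀τ = extension-down e reflects-< A⊨φ₀τ
        B⊭φ₁τ∧γ : B ⊨ φ₁τ → ¬ B ⊨ γ
        B⊭φ₁τ∧γ B⊨φ₁τ B⊨γ = A⊭φ₁τ∧γ (lift φ₁τ B⊨φ₁τ) (lift γ B⊨γ)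
          where
          order : OrderAxioms A
          order = extension-order A⊨φ₀τ
          finite : Finite B
          finite = em⇒dne lem λ infinite → no-infinite (B , infinite , B⊨φ₀τ , B⊨φ₁τ , B⊨γ)
          lift : ∀ φ → B ⊨ φ → A ⊨ φ
          lift φ = sat-up e (φ₁τ⇒reflects e order reflects-< (extension-disjoint A⊨φ₀τ) B⊨φ₁τ)
                            (φ₁⇒onto e order reflects-< (proj₁ B⊨φ₁τ) finite) φ (λ ())

      ∀ⁿ-holds-in-larger-models : ExcludedMiddle 0ℓ → ∀ {M n k} {μ : Formula k} →
        M ⊨ φ₀τ → Fin n ↔ Carrier M → k < n → QF μ →
        (∀ B → Finite B → B ⊨ χ φ₀τ γ → B ⊨ ∀ⁿ k μ) → M ⊨ ∀ⁿ k μ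
      -- A 0-tuple has no image to induce a substructure on (universes are nonempty), so a
      -- one-point structure without relations is used; closed quantifier-free sentences
      -- have the same truth value in every structure.
      ∀ⁿ-holds-in-larger-models _ {k = zero} {μ} M⊨φ₀τ _ _ q holds =
        closed-qf-absolute μ q (holds point-structure (1 , 1↔⊤) (point-model {γ = γ} M⊨φ₀τ))
      ∀ⁿ-holds-in-larger-models lem {M} {k = suc k} {μ} M⊨φ₀τ enumeration k<n q holds =
        ∀ⁿ-intro M (suc k) μ sat
        where
        sat : ∀ ρ → Sat M μ ρ
        sat ρ = qf-transfer e false μ q (λ R → inj₂ λ xs r → r) (λ i → sym (proj₂ (index i)))
                  (∀ⁿ-elim B (suc k) μ (holds B (size , ↔-id (Fin size)) B⊨χ) (proj₁ ∘ index))
          where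
          open Image (image (λ x y → lem) ρ)
          B : Structure
          B = induced M enum (proj₁ (index zero))
          e : Embedding B M
          e = induced-embedding M enum _ enum-injective
          B⊨φ₀τ : B ⊨ φ₀τ
          B⊨φ₀τ = extension-down e (λ xs r → r) M⊨φ₀τ
          covers : B ⊨ φ₁ → ∀ c → ∃[ i ] ρ i ≡ c
          covers B⊨φ₁ c with φ₁⇒onto e (extension-order M⊨φ₀τ) (λ xs r → r) B⊨φ₁ (size , ↔-id (Fin size)) c
          ... | j , enum-j≡c = proj₁ (preimage j) , trans (proj₂ (preimage j)) enum-j≡c
          B⊨χ : B ⊨ χ φ₀τ γ
          B⊨χ = B⊨φ₀τ , λ B⊨φ₁τ _ → <⇒≱ k<n (onto⇒≤ enumeration ρ (covers (proj₁ B⊨φ₁τ)))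

      χ-universal-arity : ExcludedMiddle 0ℓ → ∀ {m} →
        Σ Structure (λ M → FiniteAtLeast m M × (M ⊨ (φ₀τ ∧' φ₁τ ∧' γ))) →
        (k : ℕ) (μ₀ : Formula k) → QF μ₀ → FinitelyEquivalent (∀ⁿ k μ₀) (χ φ₀τ γ) → m ≤ k
      χ-universal-arity lem (M , (n , m≤n , enum) , M⊨φ₀τ , M⊨φ₁τ , M⊨γ) k μ₀ q equivalent =
        ≮⇒≥ λ k<m → proj₂ (proj₁ (equivalent M (n , enum)) (M⊨∀μ₀ k<m)) M⊨φ₁τ M⊨γ
        where
        M⊨∀μ₀ : k < _ → M ⊨ ∀ⁿ k μ₀
        M⊨∀μ₀ k<m = ∀ⁿ-holds-in-larger-models lem M⊨φ₀τ enum (<-≤-trans k<m m≤n) q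
                      (λ B finite → proj₂ (equivalent B finite))

proposition3p11 : ExcludedMiddle 0ℓ → (σ : PairSig) → let open Logic σ in
    (φ₀τ : Sentence) → IsExtension φ₀τ →
    (m : ℕ) → 1 ≤ m → (γ : Sentence) →
    ¬ (Σ Structure λ M → Infinite M × (M ⊨ (φ₀τ ∧' φ₁τ ∧' γ))) →
    Σ Structure (λ M → FiniteAtLeast m M × (M ⊨ (φ₀τ ∧' φ₁τ ∧' γ))) →
    ClosedUnderLtSubstructures (χ φ₀τ γ)
      × ((k : ℕ) (μ₀ : Formula k) → QF μ₀ →
           FinitelyEquivalent (∀ⁿ k μ₀) (χ φ₀τ γ) → m ≤ k)
proposition3p11 lem σ φ₀τ extension m _ γ no-infinite large-model =
  χ-closed σ extension γ lem no-infinite , χ-universal-arity σ extension γ lem large-model
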